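{- Let $m, n, s \in \mathbb{Z}_{\geq 0}$. If $m \equiv n \pmod{s!}$, then the $s$-prefixes of the factoradic forms of $m$ and $n$ have the same inversion sets; that is, for all $0 \le i < j \le s-1$, the value $\mathrm{inv}(i,j)$ computed for the factoradic form of $m$ equals the value $\mathrm{inv}(i,j)$ computed for the factoradic form of $n$.
   Context: A permutation $\sigma$ of $\mathbb{Z}_{\geq 0}$ is called tame if $\sigma(i)=i$ for all but finitely many $i$; it is written as the sequence $(\sigma(0),\sigma(1),\sigma(2),\dots)$. The factoradic order on tame permutations is defined as follows: for distinct tame $\sigma,\tau$, let $p$ be the largest index with $\sigma(p)\neq\tau(p)$; then $\sigma$ precedes $\tau$ if and only if $\sigma(p)>\tau(p)$ (i.e. the inverse of the right-to-left lexicographic order). This is a linear order isomorphic to $(\mathbb{Z}_{\geq 0},<)$, and the factoradic form of $n\in\mathbb{Z}_{\geq0}$ is the $n$-th tame permutation in this order, counting from $0$ (so $0$ corresponds to the identity $(0,1,2,\dots)$, $1$ to $(1,0,2,\dots)$, $2$ to $(0,2,1,\dots)$, $3$ to $(2,0,1,\dots)$, $4$ to $(1,2,0,\dots)$). For $s\ge 0$, the $s$-prefix of a tame permutation $\sigma$ is the finite sequence $(\sigma(0),\dots,\sigma(s-1))$. The inversion set of the $s$-prefix is the function on pairs $0\le i<j\le s-1$ given by $\mathrm{inv}(i,j)=1$ if $\sigma(i)>\sigma(j)$ and $\mathrm{inv}(i,j)=0$ otherwise. -}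

module Defs where

open import Data.Nat using (ℕ; _+_; _*_; _<_; _≤_; _>_)
open import Data.Bool using (Bool)
open import Data.Nat.Base using (_<ᵇ_)
open import Data.Product using (Σ; ∃; _×_)
open import Relation.Binary.PropositionalEquality using (_≡_)
open import Function.Definitions using (Injective; Surjective)

record TamePerm : Set where
  field
    perm    : ℕ → ℕ
    inj     : Injective _≡_ _≡_ perm
    surj    : Surjective _≡_ _≡_ perm
    bound   : ℕ
    fixes   : ∀ i → bound ≤ i → perm i ≡ i
open TamePerm public

_≈ₜ_ : TamePerm → TamePerm → Set
σ ≈ₜ τ = ∀ i → perm σ i ≡ perm τ i

_≺_ : TamePerm → TamePerm → Set
σ ≺ τ = ∃ λ p → (perm σ p > perm τ p) × (∀ q → p < q → perm σ q ≡ perm τ q)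

-- F enumerates the tame permutations in factoradic order, i.e. F is an
-- order isomorphism (ℕ, <) ≅ (tame permutations, ≺); F n is then the
-- n-th tame permutation (counting from 0), the factoradic form of n.
record IsFactoradicEnumeration (F : ℕ → TamePerm) : Set where
  field
    strictMono : ∀ m n → m < n → F m ≺ F n
    onto       : ∀ τ → ∃ λ n → F n ≈ₜ τ

inv : TamePerm → ℕ → ℕ → Bool
inv σ i j = perm σ j <ᵇ perm σ i

_≡_[mod_] : ℕ → ℕ → ℕ → Set
m ≡ n [mod k ] = ∃ λ a → ∃ λ b → m + a * k ≡ n + b * k

-- A factoradic enumeration is unique: two order isomorphisms from ℕ onto the tame permutations
-- differ by a strictly increasing bijection of ℕ, i.e. by the identity. So F n is the explicit
-- Lehmer-code permutation lehmer n n. Writing n = r + d · (N + 1)!, the permutation lehmer (N + 1) n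
-- restricted to [0, N] is lehmer N r followed by a map increasing on [0, N]; descending to N = s − 1,
-- the inversions among the first s positions are those of lehmer (s − 1) (n mod s!).
module Submission where

open import Defs
open import Data.Empty using (⊥-elim)
open import Data.Nat
open import Data.Nat.DivMod
open import Data.Nat.Divisibility using (∣⇒≤; m≤n⇒m!∣n!; n∣m*n)
open import Data.Nat.Properties
open import Data.Product using (∃; _×_; _,_; proj₁; proj₂)
open import Data.Sum using (inj₁; inj₂)
open import Function.Base using (_∘_)
open import Function.Bundles using (_⇔_; mk⇔)
open import Function.Definitions using (Injective)
open import Relation.Binary using (tri<; tri≈; tri>)
open import Relation.Binary.PropositionalEquality
open import Relation.Nullary using (¬_; yes; no)
open import Relation.Nullary.Decidable using (does-⇔)

-- For v ≤ M, rotate M v is the cycle v ↦ v + 1 ↦ ⋯ ↦ M ↦ v.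
rotate : ℕ → ℕ → ℕ → ℕ
rotate M v x with x <? v | <-cmp x M
... | yes _ | _          = x
... | no _  | tri< _ _ _ = suc x
... | no _  | tri≈ _ _ _ = v
... | no _  | tri> _ _ _ = x

unrotate : ℕ → ℕ → ℕ → ℕ
unrotate M v y with <-cmp y v | y ≤? M
... | tri< _ _ _ | _     = y
... | tri≈ _ _ _ | _     = M
... | tri> _ _ _ | yes _ = pred y
... | tri> _ _ _ | no _  = y

module _ {M v : ℕ} where

  rotate-below : ∀ {x} → x < v → rotate M v x ≡ x
  rotate-below {x} x<v with x <? v
  ... | yes _  = refl
  ... | no x≮v = ⊥-elim (x≮v x<v)

  rotate-between : ∀ {x} → v ≤ x → x < M → rotate M v x ≡ suc x
  rotate-between {x} v≤x x<M with x <? v | <-cmp x M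
  ... | yes x<v | _          = ⊥-elim (<⇒≱ x<v v≤x)
  ... | no _    | tri< _ _ _ = refl
  ... | no _    | tri≈ x≮M _ _ = ⊥-elim (x≮M x<M)
  ... | no _    | tri> x≮M _ _ = ⊥-elim (x≮M x<M)

  rotate-top : v ≤ M → rotate M v M ≡ v
  rotate-top v≤M with M <? v | <-cmp M M
  ... | yes M<v | _            = ⊥-elim (<⇒≱ M<v v≤M)
  ... | no _    | tri< M<M _ _ = ⊥-elim (<-irrefl refl M<M)
  ... | no _    | tri≈ _ _ _   = refl
  ... | no _    | tri> _ _ M<M = ⊥-elim (<-irrefl refl M<M)

  rotate-above : ∀ {x} → v ≤ M → M < x → rotate M v x ≡ x
  rotate-above {x} v≤M M<x with x <? v | <-cmp x M
  ... | yes _ | _            = refl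
  ... | no _  | tri< x<M _ _ = ⊥-elim (<-asym x<M M<x)
  ... | no _  | tri≈ _ x≡M _ = ⊥-elim (<-irrefl (sym x≡M) M<x)
  ... | no _  | tri> _ _ _   = refl

  rotate-≤ : ∀ {x} → v ≤ M → x ≤ M → rotate M v x ≤ M
  rotate-≤ {x} v≤M x≤M with <-≤-connex x v | m≤n⇒m<n∨m≡n x≤M
  ... | inj₁ x<v | _         = subst (_≤ M) (sym (rotate-below x<v)) x≤M
  ... | inj₂ v≤x | inj₁ x<M  = subst (_≤ M) (sym (rotate-between v≤x x<M)) x<M
  ... | inj₂ _   | inj₂ refl = subst (_≤ M) (sym (rotate-top v≤M)) v≤M

  rotate-<-mono : ∀ {x y} → x < y → y < M → rotate M v x < rotate M v y
  rotate-<-mono {x} {y} x<y y<M with <-≤-connex x v | <-≤-connex y v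
  ... | inj₁ x<v | inj₁ y<v = subst₂ _<_ (sym (rotate-below x<v)) (sym (rotate-below y<v)) x<y
  ... | inj₁ x<v | inj₂ v≤y =
    subst₂ _<_ (sym (rotate-below x<v)) (sym (rotate-between v≤y y<M)) (m<n⇒m<1+n x<y)
  ... | inj₂ v≤x | inj₁ y<v = ⊥-elim (<⇒≱ (<-trans x<y y<v) v≤x)
  ... | inj₂ v≤x | inj₂ v≤y =
    subst₂ _<_ (sym (rotate-between v≤x (<-trans x<y y<M))) (sym (rotate-between v≤y y<M)) (s<s x<y)

  rotate-<-⇔ : ∀ {x y} → x < M → y < M → x < y ⇔ rotate M v x < rotate M v y
  rotate-<-⇔ {x} {y} x<M y<M = mk⇔ (λ x<y → rotate-<-mono x<y y<M) reflect
    where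
    reflect : rotate M v x < rotate M v y → x < y
    reflect fx<fy with <-cmp x y
    ... | tri< x<y _ _ = x<y
    ... | tri≈ _ refl _ = ⊥-elim (<-irrefl refl fx<fy)
    ... | tri> _ _ y<x = ⊥-elim (<-asym fx<fy (rotate-<-mono y<x x<M))

  unrotate-below : ∀ {y} → y < v → unrotate M v y ≡ y
  unrotate-below {y} y<v with <-cmp y v
  ... | tri< _ _ _   = refl
  ... | tri≈ y≮v _ _ = ⊥-elim (y≮v y<v)
  ... | tri> y≮v _ _ = ⊥-elim (y≮v y<v)

  unrotate-pivot : unrotate M v v ≡ M
  unrotate-pivot with <-cmp v v
  ... | tri< _ v≢v _ = ⊥-elim (v≢v refl)
  ... | tri≈ _ _ _   = refl
  ... | tri> _ v≢v _ = ⊥-elim (v≢v refl)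

  unrotate-between : ∀ {y} → v < y → y ≤ M → unrotate M v y ≡ pred y
  unrotate-between {y} v<y y≤M with <-cmp y v | y ≤? M
  ... | tri< _ _ v≮y | _       = ⊥-elim (v≮y v<y)
  ... | tri≈ _ _ v≮y | _       = ⊥-elim (v≮y v<y)
  ... | tri> _ _ _   | yes _   = refl
  ... | tri> _ _ _   | no y≰M  = ⊥-elim (y≰M y≤M)

  unrotate-above : ∀ {y} → v ≤ M → M < y → unrotate M v y ≡ y
  unrotate-above {y} v≤M M<y with <-cmp y v | y ≤? M
  ... | tri< y<v _ _ | _       = refl
  ... | tri≈ _ refl _ | _      = ⊥-elim (<⇒≱ M<y v≤M)
  ... | tri> _ _ _   | yes y≤M = ⊥-elim (<⇒≱ M<y y≤M)
  ... | tri> _ _ _   | no _    = refl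

  rotate-unrotate : v ≤ M → ∀ y → rotate M v (unrotate M v y) ≡ y
  rotate-unrotate v≤M y with <-≤-connex y v
  ... | inj₁ y<v = trans (cong (rotate M v) (unrotate-below y<v)) (rotate-below y<v)
  ... | inj₂ v≤y with m≤n⇒m<n∨m≡n v≤y
  ... | inj₂ refl = trans (cong (rotate M v) unrotate-pivot) (rotate-top v≤M)
  ... | inj₁ v<y with <-≤-connex M y
  ... | inj₁ M<y = trans (cong (rotate M v) (unrotate-above v≤M M<y)) (rotate-above v≤M M<y)
  rotate-unrotate v≤M (suc y) | inj₂ _ | inj₁ v<1+y@(s≤s v≤y) | inj₂ 1+y≤M =
    trans (cong (rotate M v) (unrotate-between v<1+y 1+y≤M)) (rotate-between v≤y 1+y≤M)

  unrotate-rotate : v ≤ M → ∀ x → unrotate M v (rotate M v x) ≡ x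
  unrotate-rotate v≤M x with <-≤-connex x v
  ... | inj₁ x<v = trans (cong (unrotate M v) (rotate-below x<v)) (unrotate-below x<v)
  ... | inj₂ v≤x with <-≤-connex M x
  ... | inj₁ M<x = trans (cong (unrotate M v) (rotate-above v≤M M<x)) (unrotate-above v≤M M<x)
  ... | inj₂ x≤M with m≤n⇒m<n∨m≡n x≤M
  ... | inj₁ x<M =
    trans (cong (unrotate M v) (rotate-between v≤x x<M)) (unrotate-between (s≤s v≤x) x<M)
  ... | inj₂ refl = trans (cong (unrotate M v) (rotate-top v≤M)) unrotate-pivot

rotate-self : ∀ M x → rotate M M x ≡ x
rotate-self M x with x <? M | <-cmp x M
... | yes _ | _             = refl
... | no x≮M | tri< x<M _ _ = ⊥-elim (x≮M x<M)
... | no _  | tri≈ _ x≡M _  = sym x≡M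
... | no _  | tri> _ _ _    = refl

infixl 7 _/!_ _%!_

_/!_ _%!_ : ℕ → ℕ → ℕ
n /! k = (n / k !) {{k !≢0}}
n %! k = (n % k !) {{k !≢0}}

module _ {n k : ℕ} where

  %!+/!* : n ≡ n %! k + n /! k * k !
  %!+/!* = m≡m%n+[m/n]*n n (k !) {{k !≢0}}

  %!-< : n %! k < k !
  %!-< = m%n<n n (k !) {{k !≢0}}

  /!-≤ : n < suc k ! → n /! k ≤ k
  /!-≤ n<[1+k]! = s≤s⁻¹ (m<n*o⇒m/o<n {{k !≢0}} n<[1+k]!)

  /!-small : n < k ! → n /! k ≡ 0
  /!-small = m<n⇒m/n≡0 {{k !≢0}}

  %!-small : n < k ! → n %! k ≡ n
  %!-small = m<n⇒m%n≡m {{k !≢0}}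

!-mono-≤ : ∀ {m n} → m ≤ n → m ! ≤ n !
!-mono-≤ {n = n} m≤n = ∣⇒≤ {{n !≢0}} (m≤n⇒m!∣n! m≤n)

n<[1+n]! : ∀ n → n < suc n !
n<[1+n]! n = m≤m*n (suc n) (n !) {{n !≢0}}

%!-%! : ∀ {j k} n → j ≤ k → n %! k %! j ≡ n %! j
%!-%! {j} {k} n j≤k = m∣n⇒o%n%m≡o%m (j !) (k !) n {{j !≢0}} {{k !≢0}} (m≤n⇒m!∣n! j≤k)

/!-≡⇒%!-< : ∀ {k m n} → m < n → m /! k ≡ n /! k → m %! k < n %! k
/!-≡⇒%!-< {k} {m} {n} m<n q≡ = +-cancelʳ-< (m /! k * k !) (m %! k) (n %! k) (begin-strict
  m %! k + m /! k * k !  ≡⟨ %!+/!* {m} {k} ⟨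
  m                      <⟨ m<n ⟩
  n                      ≡⟨ %!+/!* {n} {k} ⟩
  n %! k + n /! k * k !  ≡⟨ cong (λ q → n %! k + q * k !) q≡ ⟨
  n %! k + m /! k * k !  ∎)
  where open ≤-Reasoning

module _ {r c k : ℕ} (r<k! : r < k !) where

  /!-encode : (r + c * k !) /! k ≡ c
  /!-encode = begin
    (r + c * k !) /! k                              ≡⟨ +-distrib-/-∣ʳ r {{k !≢0}} (n∣m*n c) ⟩
    (r / k !) {{k !≢0}} + (c * k ! / k !) {{k !≢0}} ≡⟨ cong₂ _+_ (/!-small {r} {k} r<k!) (m*n/n≡m c (k !) {{k !≢0}}) ⟩
    c                                               ∎
    where open ≡-Reasoning

  %!-encode : (r + c * k !) %! k ≡ r
  %!-encode = trans ([m+kn]%n≡m%n r c (k !) {{k !≢0}}) (%!-small {r} {k} r<k!)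

≡[mod!]⇒%!-≡ : ∀ {m n k} → m ≡ n [mod k ! ] → m %! k ≡ n %! k
≡[mod!]⇒%!-≡ {m} {n} {k} (a , b , m+ak!≡n+bk!) = begin
  m %! k                ≡⟨ [m+kn]%n≡m%n m a (k !) {{k !≢0}} ⟨
  (m + a * k !) %! k    ≡⟨ cong (_%! k) m+ak!≡n+bk! ⟩
  (n + b * k !) %! k    ≡⟨ [m+kn]%n≡m%n n b (k !) {{k !≢0}} ⟩
  n %! k                ∎
  where open ≡-Reasoning

pivot : ℕ → ℕ → ℕ
pivot N n = suc N ∸ n /! suc N

pivot-≤ : ∀ N n → pivot N n ≤ suc N
pivot-≤ N n = m∸n≤m (suc N) (n /! suc N)

-- Lehmer codes: writing n = r + d · (N + 1)! with r < (N + 1)!, the permutation lehmer (N + 1) n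
-- of [0, N + 1] puts N + 1 − d at position N + 1 and lays out the remaining values on [0, N]
-- in the same relative order as lehmer N r. (Only for n < (N + 2)! is d ≤ N + 1, so that the
-- truncated subtraction in pivot is the true one.)
lehmer : ℕ → ℕ → ℕ → ℕ
lehmer zero    n x = x
lehmer (suc N) n x = rotate (suc N) (pivot N n) (lehmer N (n %! suc N) x)

lehmer⁻¹ : ℕ → ℕ → ℕ → ℕ
lehmer⁻¹ zero    n y = y
lehmer⁻¹ (suc N) n y = lehmer⁻¹ N (n %! suc N) (unrotate (suc N) (pivot N n) y)

lehmer-above : ∀ N n {x} → N < x → lehmer N n x ≡ x
lehmer-above zero    n N<x = refl
lehmer-above (suc N) n N<x =
  trans (cong (rotate (suc N) (pivot N n)) (lehmer-above N (n %! suc N) (<-trans (n<1+n N) N<x)))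
        (rotate-above (pivot-≤ N n) N<x)

lehmer-top : ∀ N n → lehmer (suc N) n (suc N) ≡ pivot N n
lehmer-top N n = trans (cong (rotate (suc N) (pivot N n)) (lehmer-above N (n %! suc N) (n<1+n N)))
                       (rotate-top (pivot-≤ N n))

lehmer-≤ : ∀ N n {x} → x ≤ N → lehmer N n x ≤ N
lehmer-≤ zero    n x≤0 = x≤0
lehmer-≤ (suc N) n {x} x≤1+N with m≤n⇒m<n∨m≡n x≤1+N
... | inj₁ (s≤s x≤N) = rotate-≤ (pivot-≤ N n) (m≤n⇒m≤1+n (lehmer-≤ N (n %! suc N) x≤N))
... | inj₂ refl      = subst (_≤ suc N) (sym (lehmer-top N n)) (pivot-≤ N n)

lehmer-lehmer⁻¹ : ∀ N n y → lehmer N n (lehmer⁻¹ N n y) ≡ y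
lehmer-lehmer⁻¹ zero    n y = refl
lehmer-lehmer⁻¹ (suc N) n y =
  trans (cong (rotate (suc N) (pivot N n)) (lehmer-lehmer⁻¹ N (n %! suc N) _))
        (rotate-unrotate (pivot-≤ N n) y)

lehmer⁻¹-lehmer : ∀ N n x → lehmer⁻¹ N n (lehmer N n x) ≡ x
lehmer⁻¹-lehmer zero    n x = refl
lehmer⁻¹-lehmer (suc N) n x =
  trans (cong (lehmer⁻¹ N (n %! suc N)) (unrotate-rotate (pivot-≤ N n) _))
        (lehmer⁻¹-lehmer N (n %! suc N) x)

lehmerPerm : ℕ → ℕ → TamePerm
lehmerPerm N n = record
  { perm  = lehmer N n
  ; inj   = λ {x} {y} eq →
      trans (sym (lehmer⁻¹-lehmer N n x)) (trans (cong (lehmer⁻¹ N n) eq) (lehmer⁻¹-lehmer N n y))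
  ; surj  = λ y → lehmer⁻¹ N n y , λ {z} z≡ → trans (cong (lehmer N n) z≡) (lehmer-lehmer⁻¹ N n y)
  ; bound = suc N
  ; fixes = λ i → lehmer-above N n
  }

lehmer-extend : ∀ {N N' n} → N ≤ N' → n < suc N ! → lehmer N' n ≗ lehmer N n
lehmer-extend {N} {n = n} N≤N' n<[1+N]! = go (≤⇒≤′ N≤N')
  where
  go : ∀ {N'} → N ≤′ N' → lehmer N' n ≗ lehmer N n
  go ≤′-refl               x = refl
  go (≤′-step {N'} N≤′N') x = begin
    rotate (suc N') (suc N' ∸ n /! suc N') (lehmer N' (n %! suc N') x)
      ≡⟨ cong₂ (λ d r → rotate (suc N') (suc N' ∸ d) (lehmer N' r x))
               (/!-small {n} {suc N'} n<[1+N']!) (%!-small {n} {suc N'} n<[1+N']!) ⟩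
    rotate (suc N') (suc N') (lehmer N' n x)  ≡⟨ rotate-self (suc N') _ ⟩
    lehmer N' n x                             ≡⟨ go N≤′N' x ⟩
    lehmer N n x                              ∎
    where
    open ≡-Reasoning
    n<[1+N']! : n < suc N' !
    n<[1+N']! = <-≤-trans n<[1+N]! (!-mono-≤ (s≤s (≤′⇒≤ N≤′N')))

lehmer-canonical : ∀ N {n} → n < suc N ! → lehmer N n ≗ lehmer n n
lehmer-canonical N {n} n<[1+N]! with ≤-total N n
... | inj₁ N≤n = λ x → sym (lehmer-extend N≤n n<[1+N]! x)
... | inj₂ n≤N = lehmer-extend n≤N (n<[1+n]! n)

lehmer-≺-by-pivot : ∀ {N n n'} → n /! suc N < n' /! suc N → n' < suc (suc N) ! →
                    lehmerPerm (suc N) n ≺ lehmerPerm (suc N) n'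
lehmer-≺-by-pivot {N} {n} {n'} d<d' n'<! = suc N , pivot-> , agree
  where
  pivot-> : lehmer (suc N) n' (suc N) < lehmer (suc N) n (suc N)
  pivot-> = subst₂ _<_ (sym (lehmer-top N n')) (sym (lehmer-top N n)) (∸-monoʳ-< d<d' (/!-≤ {n'} {suc N} n'<!))
  agree : ∀ q → suc N < q → lehmer (suc N) n q ≡ lehmer (suc N) n' q
  agree q N<q = trans (lehmer-above (suc N) n N<q) (sym (lehmer-above (suc N) n' N<q))

lehmer-≺-by-rest : ∀ {N n n'} → n /! suc N ≡ n' /! suc N →
                   lehmerPerm N (n %! suc N) ≺ lehmerPerm N (n' %! suc N) →
                   lehmerPerm (suc N) n ≺ lehmerPerm (suc N) n'
lehmer-≺-by-rest {N} {n} {n'} d≡d' (p , differ , agree) = p , differ' , agree'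
  where
  r r' : ℕ
  r  = n %! suc N
  r' = n' %! suc N
  p≤N : p ≤ N
  p≤N with <-≤-connex N p
  ... | inj₁ N<p = ⊥-elim (<-irrefl (trans (lehmer-above N r' N<p) (sym (lehmer-above N r N<p))) differ)
  ... | inj₂ p≤N = p≤N
  pivot≡ : pivot N n ≡ pivot N n'
  pivot≡ = cong (suc N ∸_) d≡d'
  differ' : lehmer (suc N) n' p < lehmer (suc N) n p
  differ' = subst (λ v → rotate (suc N) v (lehmer N r' p) < lehmer (suc N) n p) pivot≡
                  (rotate-<-mono {suc N} {pivot N n} differ (s≤s (lehmer-≤ N r p≤N)))
  agree' : ∀ q → p < q → lehmer (suc N) n q ≡ lehmer (suc N) n' q
  agree' q p<q = cong₂ (rotate (suc N)) pivot≡ (agree q p<q)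

lehmer-strictMono : ∀ N {n n'} → n < n' → n' < suc N ! → lehmerPerm N n ≺ lehmerPerm N n'
lehmer-strictMono zero    {n' = zero}  () _
lehmer-strictMono zero    {n' = suc _} _  (s≤s ())
lehmer-strictMono (suc N) {n} {n'} n<n' n'<! with m≤n⇒m<n∨m≡n (/-monoˡ-≤ (suc N !) {{suc N !≢0}} (<⇒≤ n<n'))
... | inj₁ d<d' = lehmer-≺-by-pivot {N} d<d' n'<!
... | inj₂ d≡d' =
  lehmer-≺-by-rest {N} d≡d' (lehmer-strictMono N (/!-≡⇒%!-< {suc N} n<n' d≡d') (%!-< {n'} {suc N}))

injective-fixing-≥-preserves-< : ∀ {f : ℕ → ℕ} {b x} → Injective _≡_ _≡_ f →
                                 (∀ i → b ≤ i → f i ≡ i) → x < b → f x < b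
injective-fixing-≥-preserves-< {f} {b} {x} f-inj fixes x<b with <-≤-connex (f x) b
... | inj₁ fx<b = fx<b
... | inj₂ b≤fx = ⊥-elim (<⇒≱ x<b (subst (b ≤_) (f-inj (fixes (f x) b≤fx)) b≤fx))

lehmer-suc-code : ∀ {b r v} → r < suc b ! → v ≤ suc b →
                  lehmer (suc b) (r + (suc b ∸ v) * suc b !) ≗ rotate (suc b) v ∘ lehmer b r
lehmer-suc-code {b} {r} {v} r<! v≤ x =
  trans (cong₂ (λ d r → rotate (suc b) (suc b ∸ d) (lehmer b r x))
               (/!-encode {r} {suc b ∸ v} {suc b} r<!) (%!-encode {r} {suc b ∸ v} {suc b} r<!))
        (cong (λ w → rotate (suc b) w (lehmer b r x)) (m∸[m∸n]≡n v≤))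

lehmer-complete : ∀ b (f : ℕ → ℕ) → Injective _≡_ _≡_ f → (∀ i → suc b ≤ i → f i ≡ i) →
                  ∃ λ k → k < suc b ! × f ≗ lehmer b k
lehmer-complete zero f f-inj fixes = 0 , s≤s z≤n , f≗id
  where
  f≗id : f ≗ lehmer 0 0
  f≗id zero    = n<1⇒n≡0 (injective-fixing-≥-preserves-< f-inj fixes (s≤s z≤n))
  f≗id (suc x) = fixes (suc x) (s≤s z≤n)
lehmer-complete (suc b) f f-inj fixes = prepend (lehmer-complete b g g-inj g-fixes)
  where
  v : ℕ
  v = f (suc b)
  v≤ : v ≤ suc b
  v≤ = s≤s⁻¹ (injective-fixing-≥-preserves-< f-inj fixes (n<1+n (suc b)))
  g : ℕ → ℕ
  g = unrotate (suc b) v ∘ f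
  f≗rotate-g : f ≗ rotate (suc b) v ∘ g
  f≗rotate-g x = sym (rotate-unrotate v≤ (f x))
  g-inj : Injective _≡_ _≡_ g
  g-inj {x} {y} gx≡gy = f-inj (trans (f≗rotate-g x) (trans (cong (rotate (suc b) v) gx≡gy) (sym (f≗rotate-g y))))
  g-fixes : ∀ i → suc b ≤ i → g i ≡ i
  g-fixes i 1+b≤i with m≤n⇒m<n∨m≡n 1+b≤i
  ... | inj₁ 1+b<i = trans (cong (unrotate (suc b) v) (fixes i 1+b<i)) (unrotate-above v≤ 1+b<i)
  ... | inj₂ refl  = unrotate-pivot {suc b} {v}
  prepend : (∃ λ r → r < suc b ! × g ≗ lehmer b r) → ∃ λ k → k < suc (suc b) ! × f ≗ lehmer (suc b) k
  prepend (r , r<! , g≗) =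
    r + (suc b ∸ v) * suc b ! ,
    +-mono-<-≤ r<! (*-monoˡ-≤ (suc b !) (m∸n≤m (suc b) v)) ,
    λ x → trans (f≗rotate-g x) (trans (cong (rotate (suc b) v) (g≗ x)) (sym (lehmer-suc-code r<! v≤ x)))

≈ₜ-sym : ∀ {σ τ} → σ ≈ₜ τ → τ ≈ₜ σ
≈ₜ-sym σ≈τ i = sym (σ≈τ i)

≈ₜ-trans : ∀ {σ τ υ} → σ ≈ₜ τ → τ ≈ₜ υ → σ ≈ₜ υ
≈ₜ-trans σ≈τ τ≈υ i = trans (σ≈τ i) (τ≈υ i)

≺-resp-≈ₜ : ∀ {σ σ' τ τ'} → σ ≈ₜ σ' → τ ≈ₜ τ' → σ ≺ τ → σ' ≺ τ'
≺-resp-≈ₜ σ≈σ' τ≈τ' (p , differ , agree) =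
  p , subst₂ _<_ (τ≈τ' p) (σ≈σ' p) differ , λ q p<q → trans (sym (σ≈σ' q)) (trans (agree q p<q) (τ≈τ' q))

≺-irrefl : ∀ {σ τ} → σ ≈ₜ τ → ¬ σ ≺ τ
≺-irrefl σ≈τ (p , differ , _) = <-irrefl (sym (σ≈τ p)) differ

≺-trans : ∀ {σ τ υ} → σ ≺ τ → τ ≺ υ → σ ≺ υ
≺-trans {σ} {τ} {υ} (p , σ>τ , σ≡τ) (q , τ>υ , τ≡υ) with <-cmp p q
... | tri< p<q _ _ = q , subst (perm υ q <_) (sym (σ≡τ q p<q)) τ>υ ,
                     λ t q<t → trans (σ≡τ t (<-trans p<q q<t)) (τ≡υ t q<t)
... | tri≈ _ refl _ = p , <-trans τ>υ σ>τ , λ t p<t → trans (σ≡τ t p<t) (τ≡υ t p<t)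
... | tri> _ _ q<p = p , subst (_< perm σ p) (τ≡υ p q<p) σ>τ ,
                     λ t p<t → trans (σ≡τ t p<t) (τ≡υ t (<-trans q<p p<t))

module _ {F : ℕ → TamePerm} (strictMono : ∀ m n → m < n → F m ≺ F n) where

  strictMono⇒reflects-< : ∀ {m n} → F m ≺ F n → m < n
  strictMono⇒reflects-< {m} {n} Fm≺Fn with <-cmp m n
  ... | tri< m<n _ _  = m<n
  ... | tri≈ _ refl _ = ⊥-elim (≺-irrefl {F m} {F m} (λ _ → refl) Fm≺Fn)
  ... | tri> _ _ n<m  = ⊥-elim (≺-irrefl {F m} {F m} (λ _ → refl) (≺-trans {F m} {F n} {F m} Fm≺Fn (strictMono n m n<m)))

  strictMono⇒injective : ∀ {m n} → F m ≈ₜ F n → m ≡ n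
  strictMono⇒injective {m} {n} Fm≈Fn with <-cmp m n
  ... | tri< m<n _ _ = ⊥-elim (≺-irrefl {F m} {F n} Fm≈Fn (strictMono m n m<n))
  ... | tri≈ _ m≡n _ = m≡n
  ... | tri> _ _ n<m = ⊥-elim (≺-irrefl {F n} {F m} (≈ₜ-sym {F m} {F n} Fm≈Fn) (strictMono n m n<m))

<-mono⇒≤ : ∀ {f : ℕ → ℕ} → (∀ {m n} → m < n → f m < f n) → ∀ n → n ≤ f n
<-mono⇒≤ f-mono zero    = z≤n
<-mono⇒≤ f-mono (suc n) = ≤-<-trans (<-mono⇒≤ f-mono n) (f-mono (n<1+n n))

module _ {F G : ℕ → TamePerm} (isF : IsFactoradicEnumeration F) (isG : IsFactoradicEnumeration G) where
  open IsFactoradicEnumeration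

  reindex : ℕ → ℕ
  reindex n = proj₁ (onto isG (F n))

  reindex-≈ₜ : ∀ n → G (reindex n) ≈ₜ F n
  reindex-≈ₜ n = proj₂ (onto isG (F n))

  reindex-<-mono : ∀ {m n} → m < n → reindex m < reindex n
  reindex-<-mono {m} {n} m<n = strictMono⇒reflects-< {G} (strictMono isG)
    (≺-resp-≈ₜ {F m} {G (reindex m)} {F n} {G (reindex n)}
      (≈ₜ-sym {G (reindex m)} {F m} (reindex-≈ₜ m)) (≈ₜ-sym {G (reindex n)} {F n} (reindex-≈ₜ n)) (strictMono isF m n m<n))

enumeration-unique : ∀ {F G} → IsFactoradicEnumeration F → IsFactoradicEnumeration G → ∀ n → F n ≈ₜ G n
enumeration-unique {F} {G} isF isG n = subst (λ k → F n ≈ₜ G k) ψn≡n (≈ₜ-sym {G (ψ n)} {F n} (reindex-≈ₜ isF isG n))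
  where
  ψ φ : ℕ → ℕ
  ψ = reindex isF isG
  φ = reindex isG isF
  φψn≡n : φ (ψ n) ≡ n
  φψn≡n = strictMono⇒injective {F} (IsFactoradicEnumeration.strictMono isF)
            (≈ₜ-trans {F (φ (ψ n))} {G (ψ n)} {F n} (reindex-≈ₜ isG isF (ψ n)) (reindex-≈ₜ isF isG n))
  ψn≡n : ψ n ≡ n
  ψn≡n = ≤-antisym (subst (ψ n ≤_) φψn≡n (<-mono⇒≤ (reindex-<-mono isG isF) (ψ n)))
                   (<-mono⇒≤ (reindex-<-mono isF isG) n)

factoradic : ℕ → TamePerm
factoradic n = lehmerPerm n n

factoradic-isEnumeration : IsFactoradicEnumeration factoradic
factoradic-isEnumeration = record { strictMono = strictMono ; onto = onto }
  where
  strictMono : ∀ m n → m < n → factoradic m ≺ factoradic n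
  strictMono m n m<n =
    ≺-resp-≈ₜ {lehmerPerm n m} {factoradic m} {lehmerPerm n n} {factoradic n}
      (lehmer-canonical n (<-trans m<n (n<[1+n]! n))) (λ _ → refl) (lehmer-strictMono n m<n (n<[1+n]! n))
  onto : ∀ τ → ∃ λ n → factoradic n ≈ₜ τ
  onto τ with lehmer-complete (bound τ) (perm τ) (inj τ) (λ i b<i → fixes τ i (<⇒≤ b<i))
  ... | k , k<! , τ≗lehmer = k , λ x → sym (trans (τ≗lehmer x) (lehmer-canonical (bound τ) k<! x))

inv-resp-≈ₜ : ∀ {σ τ} → σ ≈ₜ τ → ∀ i j → inv σ i j ≡ inv τ i j
inv-resp-≈ₜ σ≈τ i j = cong₂ _<ᵇ_ (σ≈τ j) (σ≈τ i)

lehmer-inv-suc : ∀ {N n i j} → i ≤ N → j ≤ N →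
                 inv (lehmerPerm (suc N) n) i j ≡ inv (lehmerPerm N (n %! suc N)) i j
lehmer-inv-suc {N} {n} i≤N j≤N =
  sym (does-⇔ (rotate-<-⇔ {suc N} {pivot N n} (s≤s (lehmer-≤ N r j≤N)) (s≤s (lehmer-≤ N r i≤N))) (_ <? _) (_ <? _))
  where
  r : ℕ
  r = n %! suc N

lehmer-inv-restrict : ∀ {t N n i j} → t ≤ N → n < suc N ! → i ≤ t → j ≤ t →
                      inv (lehmerPerm N n) i j ≡ inv (lehmerPerm t (n %! suc t)) i j
lehmer-inv-restrict {t} {i = i} {j} t≤N₀ n<! i≤t j≤t = go (≤⇒≤′ t≤N₀) n<!
  where
  go : ∀ {N n} → t ≤′ N → n < suc N ! → inv (lehmerPerm N n) i j ≡ inv (lehmerPerm t (n %! suc t)) i j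
  go {n = n} ≤′-refl n<! = cong (λ r → inv (lehmerPerm t r) i j) (sym (%!-small {n} {suc t} n<!))
  go {suc N} {n} (≤′-step t≤′N) _ = begin
    inv (lehmerPerm (suc N) n) i j                ≡⟨ lehmer-inv-suc (≤-trans i≤t t≤N) (≤-trans j≤t t≤N) ⟩
    inv (lehmerPerm N (n %! suc N)) i j           ≡⟨ go t≤′N (%!-< {n} {suc N}) ⟩
    inv (lehmerPerm t (n %! suc N %! suc t)) i j  ≡⟨ cong (λ r → inv (lehmerPerm t r) i j) (%!-%! n (s≤s t≤N)) ⟩
    inv (lehmerPerm t (n %! suc t)) i j           ∎
    where
    open ≡-Reasoning
    t≤N : t ≤ N
    t≤N = ≤′⇒≤ t≤′N

enumeration-inv : ∀ {F} → IsFactoradicEnumeration F → ∀ {t i j} m → i ≤ t → j ≤ t →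
                  inv (F m) i j ≡ inv (lehmerPerm t (m %! suc t)) i j
enumeration-inv {F} isF {t} {i} {j} m i≤t j≤t = begin
  inv (F m) i j                        ≡⟨ inv-resp-≈ₜ {F m} {factoradic m} (enumeration-unique isF factoradic-isEnumeration m) i j ⟩
  inv (lehmerPerm m m) i j             ≡⟨ inv-resp-≈ₜ {lehmerPerm m m} {lehmerPerm (m + t) m} (λ x → sym (lehmer-canonical (m + t) m<! x)) i j ⟩
  inv (lehmerPerm (m + t) m) i j       ≡⟨ lehmer-inv-restrict (m≤n+m t m) m<! i≤t j≤t ⟩
  inv (lehmerPerm t (m %! suc t)) i j  ∎
  where
  open ≡-Reasoning
  m<! : m < suc (m + t) !
  m<! = <-≤-trans (n<[1+n]! m) (!-mono-≤ (s≤s (m≤m+n m t)))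

lemma3p2 : (F : ℕ → TamePerm) → IsFactoradicEnumeration F →
           ∀ m n s → m ≡ n [mod s ! ] →
           ∀ i j → i < j → j < s → inv (F m) i j ≡ inv (F n) i j
lemma3p2 F isF m n zero    _   i j i<j ()
lemma3p2 F isF m n (suc t) m≡n i j i<j (s≤s j≤t) = begin
  inv (F m) i j                        ≡⟨ enumeration-inv isF m i≤t j≤t ⟩
  inv (lehmerPerm t (m %! suc t)) i j  ≡⟨ cong (λ r → inv (lehmerPerm t r) i j) (≡[mod!]⇒%!-≡ {k = suc t} m≡n) ⟩
  inv (lehmerPerm t (n %! suc t)) i j  ≡⟨ enumeration-inv isF n i≤t j≤t ⟨
  inv (F n) i j                        ∎
  where
  open ≡-Reasoning
  i≤t : i ≤ t
  i≤t = <⇒≤ (<-≤-trans i<j j≤t)
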